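{- Let $X$ be an $R^+$-space and let $P\subseteq(R^+)^{|X|}$ be a covering such that $P^\perp=P(X)$. Then a countable family $(x(i))_{i\in I}$ of elements of $P(X)$ is summable (i.e. its pointwise sum $\sum_{i\in I}x(i)$ is defined and belongs to $P(X)$) if and only if, for all $x'\in P$, $\langle\sum_{i\in I}x(i),x'\rangle$ is defined (including definedness of the pointwise sum) and belongs to $\mathcal B$.
   Context: PCM: a nonempty set with a partial sum $\Sigma$ on countably indexed families ("summable" families) satisfying (Unary) singletons $(x)$ are summable with sum $x$, and (WPA) for summable $(x_a)_{a\in A}$ and a countable partition $\{A_i\}_{i\in I}$ of $A$ (parts possibly empty), each $(x_a)_{a\in A_i}$ is summable and $(\sum_{a\in A_i}x_a)_i$ is summable with sum $\sum_{a\in A}x_a$; strong if also (PA): if each $(x_a)_{a\in A_i}$ and $(\sum_{a\in A_i}x_a)_i$ are summable then $(x_a)_{a\in A}$ is summable. $0$ is the empty sum; $x\le y$ iff $x+z=y$ for some $z$. A PCR $(R,\Sigma,1,\cdot)$ is a PCM with a commutative monoid $(R,1,\cdot)$ such that for summable $(x_a),(y_b)$, $(x_ay_b)_{(a,b)}$ is summable with sum $(\sum x_a)(\sum y_b)$; strong if its PCM is strong. Setting: $R^+$ a strong PCR, $\mathcal B\subseteq R^+$ downward closed. Webs are countable sets. $\langle x,y\rangle=\sum_a x_ay_a$ (partial); $x\perp y$ iff $\langle x,y\rangle$ is defined and in $\mathcal B$; $F^\perp=\{y\mid\forall x\in F, x\perp y\}$. A covering of $(R^+)^W$ is $F$ such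 that every $a\in W$ has some $x\in F$ with $x_a$ invertible in $(R^+,1,\cdot)$. An $R^+$-space is $X=(|X|,P(X))$ with $P(X)\subseteq(R^+)^{|X|}$, $P(X)^{\perp\perp}=P(X)$, and $P(X)$, $P(X)^\perp$ coverings. The pointwise sum of vectors is $(\sum_i x(i))_a=\sum_i x(i)_a$. -}

module Defs where

open import Level using (Level; _⊔_) renaming (suc to lsuc; zero to lzero)
open import Data.Nat using (ℕ)
open import Data.Bool using (Bool; true; false; if_then_else_)
open import Data.Product using (Σ; ∃; _×_; _,_; proj₁; proj₂)
open import Function.Definitions using (Injective)
open import Function.Bundles using (_⇔_)
open import Relation.Binary.PropositionalEquality using (_≡_)
open import Algebra.Structures using (IsCommutativeMonoid)

Countable : Set → Set
Countable A = Σ (A → ℕ) (Injective _≡_ _≡_)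

-- The fibre of p : A → I over i, i.e. the part A_i of the partition of A
-- given by p (parts may be empty).
Fiber : {A I : Set} → (A → I) → I → Set
Fiber {A} p i = Σ A (λ a → p a ≡ i)

restrict : {A I R : Set} → (A → R) → (p : A → I) → (i : I) → Fiber p i → R
restrict x p i f = x (proj₁ f)

-- Partially commutative monoid: Sum x s means "the family x is summable with sum s".
record PCM : Set₁ where
  field
    Carrier : Set
    inhabited : Carrier
    Sum : {A : Set} → (A → Carrier) → Carrier → Set
    Sum-countable : {A : Set} {x : A → Carrier} {s : Carrier} → Sum x s → Countable A
    Sum-unique : {A : Set} {x : A → Carrier} {s t : Carrier} → Sum x s → Sum x t → s ≡ t
    -- families are functions, compared extensionally
    Sum-ext : {A : Set} {x y : A → Carrier} {s : Carrier} →
              (∀ a → x a ≡ y a) → Sum x s → Sum y s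
    unary : {A : Set} (c : A) → (∀ a → a ≡ c) → (x : A → Carrier) → Sum x (x c)
    wpa : {A I : Set} → Countable I → (x : A → Carrier) (s : Carrier) (p : A → I) →
          Sum x s →
          Σ (I → Carrier) (λ t → (∀ i → Sum (restrict x p i) (t i)) × Sum t s)

  Summable : {A : Set} → (A → Carrier) → Set
  Summable x = ∃ (Sum x)

  _+_≣_ : Carrier → Carrier → Carrier → Set
  x + y ≣ z = Sum (λ (b : Bool) → if b then x else y) z

  _≤_ : Carrier → Carrier → Set
  x ≤ y = ∃ (λ z → x + z ≣ y)

record StrongPCM : Set₁ where
  field
    pcm : PCM
  open PCM pcm
  field
    pa : {A I : Set} → Countable A → Countable I → (x : A → Carrier) (p : A → I) →
         (t : I → Carrier) (s : Carrier) →
         (∀ i → Sum (restrict x p i) (t i)) → Sum t s → Summable x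

-- Partially commutative rig (strong, since the setting assumes R⁺ strong).
record StrongPCR : Set₁ where
  field
    strongPCM : StrongPCM
  open StrongPCM strongPCM public
  open PCM pcm public
  field
    _·_ : Carrier → Carrier → Carrier
    one : Carrier
    isCommutativeMonoid : IsCommutativeMonoid _≡_ _·_ one
    sum-mult : {A B : Set} {x : A → Carrier} {y : B → Carrier} {s t : Carrier} →
               Sum x s → Sum y t →
               Sum (λ (ab : A × B) → x (proj₁ ab) · y (proj₂ ab)) (s · t)

  Invertible : Carrier → Set
  Invertible x = ∃ (λ y → x · y ≡ one)

module Spaces (R : StrongPCR) (𝓑 : StrongPCR.Carrier R → Set) where
  open StrongPCR R

  ⟨_,_⟩≣_ : {W : Set} → (W → Carrier) → (W → Carrier) → Carrier → Set
  ⟨ x , y ⟩≣ s = Sum (λ a → x a · y a) s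

  _⊥_ : {W : Set} → (W → Carrier) → (W → Carrier) → Set
  x ⊥ y = ∃ (λ s → (⟨ x , y ⟩≣ s) × 𝓑 s)

  _^⊥ : {W : Set} → ((W → Carrier) → Set) → (W → Carrier) → Set
  (F ^⊥) y = ∀ x → F x → x ⊥ y

  _≐_ : {W : Set} → ((W → Carrier) → Set) → ((W → Carrier) → Set) → Set
  F ≐ G = ∀ x → F x ⇔ G x

  Covering : {W : Set} → ((W → Carrier) → Set) → Set
  Covering {W} F = ∀ (a : W) → ∃ (λ x → F x × Invertible (x a))

  record Space : Set₁ where
    field
      web : Set
      web-countable : Countable web
      P : (web → Carrier) → Set
      P-biorth : ((P ^⊥) ^⊥) ≐ P
      P-covering : Covering P
      P⊥-covering : Covering (P ^⊥)

  PointwiseSum : {I W : Set} → (I → W → Carrier) → (W → Carrier) → Set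
  PointwiseSum x s = ∀ a → Sum (λ i → x i a) (s a)

DownwardClosed : (R : StrongPCR) → (StrongPCR.Carrier R → Set) → Set
DownwardClosed R 𝓑 = ∀ {x y} → 𝓑 y → x ≤ y → 𝓑 x
  where open StrongPCR R

module Submission where

open import Defs
open import Data.Product using (∃; _×_; _,_; proj₁; proj₂)
open import Function.Bundles using (_⇔_; mk⇔; Equivalence)
open import Relation.Binary.PropositionalEquality using (_≡_; refl; cong₂)
open import Algebra.Structures using (IsCommutativeMonoid)

-- Definedness of the pointwise sum is a coordinatewise question, and the sum,
-- being unique, does not depend on which x′ ∈ Q witnessed it; coordinate a is
-- read off the test vector that the covering Q provides at a.  Hence "s ⊥ x′
-- for all x′ ∈ Q" says exactly s ∈ Q^⊥ = P(X).

module _ (R : StrongPCR) (𝓑 : StrongPCR.Carrier R → Set) where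
  open StrongPCR R
  open Spaces R 𝓑

  ⊥-sym : {W : Set} {u v : W → Carrier} → u ⊥ v → v ⊥ u
  ⊥-sym (t , uv≣t , 𝓑t) =
    t , Sum-ext (λ a → IsCommutativeMonoid.comm isCommutativeMonoid _ _) uv≣t , 𝓑t

  PointwiseSum-unique : {I W : Set} {x : I → W → Carrier} {s s′ : W → Carrier} →
                        PointwiseSum x s → PointwiseSum x s′ → ∀ a → s a ≡ s′ a
  PointwiseSum-unique Σs Σs′ a = Sum-unique (Σs a) (Σs′ a)

  ⊥-respects-≗ : {W : Set} {s s′ v : W → Carrier} →
                 (∀ a → s a ≡ s′ a) → s ⊥ v → s′ ⊥ v
  ⊥-respects-≗ s≗s′ (t , sv≣t , 𝓑t) =
    t , Sum-ext (λ a → cong₂ _·_ (s≗s′ a) refl) sv≣t , 𝓑t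

  PointwiseSum-from-covering :
    {I W : Set} {x : I → W → Carrier} (Q : (W → Carrier) → Set) → Covering Q →
    (∀ x′ → Q x′ → ∃ (λ s → PointwiseSum x s × (s ⊥ x′))) →
    ∃ (λ s → PointwiseSum x s)
  PointwiseSum-from-covering {W = W} {x} Q cov H =
    (λ a → proj₁ (sumAt a) a) , (λ a → proj₁ (proj₂ (sumAt a)) a)
    where
    sumAt : (a : W) → ∃ (λ s → PointwiseSum x s × (s ⊥ proj₁ (cov a)))
    sumAt a = H (proj₁ (cov a)) (proj₁ (proj₂ (cov a)))

proposition4p4 : (R : StrongPCR) (𝓑 : StrongPCR.Carrier R → Set) → DownwardClosed R 𝓑 →
    let open StrongPCR R
        open Spaces R 𝓑
    in (X : Space) →
       let open Space X
       in (Q : (web → Carrier) → Set) → Covering Q → (Q ^⊥) ≐ P →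
          (I : Set) → Countable I → (x : I → web → Carrier) → (∀ i → P (x i)) →
          (∃ (λ s → PointwiseSum x s × P s))
            ⇔ (∀ x′ → Q x′ → ∃ (λ s → PointwiseSum x s × (s ⊥ x′)))
proposition4p4 R 𝓑 _ X Q cov Q^⊥≐P I _ x _ = mk⇔ summable⇒tested tested⇒summable
  where
  open StrongPCR R
  open Spaces R 𝓑
  open Space X

  summable⇒tested : ∃ (λ s → PointwiseSum x s × P s) →
                    ∀ x′ → Q x′ → ∃ (λ s → PointwiseSum x s × (s ⊥ x′))
  summable⇒tested (s , Σs , Ps) x′ Qx′ =
    s , Σs , ⊥-sym R 𝓑 (Equivalence.from (Q^⊥≐P s) Ps x′ Qx′)

  tested⇒summable : (∀ x′ → Q x′ → ∃ (λ s → PointwiseSum x s × (s ⊥ x′))) →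
                    ∃ (λ s → PointwiseSum x s × P s)
  tested⇒summable H with PointwiseSum-from-covering R 𝓑 Q cov H
  ... | s , Σs = s , Σs , Equivalence.to (Q^⊥≐P s) s∈Q^⊥
    where
    s∈Q^⊥ : (Q ^⊥) s
    s∈Q^⊥ x′ Qx′ with H x′ Qx′
    ... | s′ , Σs′ , s′⊥x′ =
      ⊥-sym R 𝓑 (⊥-respects-≗ R 𝓑 (PointwiseSum-unique R 𝓑 Σs′ Σs) s′⊥x′)
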